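{- Let $\ell\in\mathbb{N}$. Every $\Delta_\ell$ set contains a $\Delta_\ell$ set of zero upper Banach density.
   Context: $\mathbb{N}=\{1,2,\dots\}$. The upper Banach density of $E\subseteq\mathbb{N}$ is $d^*(E)=\limsup_{N-M\to\infty}\frac{|E\cap\{M+1,\dots,N\}|}{N-M}$. Define $\partial:\bigcup_{\ell\ge1}\mathbb{Z}^{2^\ell}\to\mathbb{Z}$ recursively by $\partial(m_1,m_2)=m_2-m_1$ and $\partial(m_1,\dots,m_{2^\ell})=\partial(m_{2^{\ell-1}+1},\dots,m_{2^\ell})-\partial(m_1,\dots,m_{2^{\ell-1}})$ for $\ell>1$. A set $E\subseteq\mathbb{N}$ is a $\Delta_\ell$ set if there is an increasing sequence $(n_k)_{k\in\mathbb{N}}$ in $\mathbb{N}$ with $\{\partial(n_{j_1},\dots,n_{j_{2^\ell}}):j_1<\dots<j_{2^\ell}\}\subseteq E$. -}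

module Defs where

open import Data.Nat using (ℕ; zero; suc; _+_; _*_; _∸_; _^_; _≤_; _<_)
open import Data.Nat.Properties using (+-identityʳ)
open import Data.Integer as ℤ using (ℤ; +_)
open import Data.Fin as Fin using (Fin)
open import Data.Vec using (Vec; []; _∷_; splitAt; cast; tabulate)
open import Data.List using (List; length)
open import Data.List.Relation.Unary.All using (All)
open import Data.List.Relation.Unary.Unique.Propositional using (Unique)
open import Data.Product using (Σ; _×_; _,_; ∃)
open import Relation.Binary.PropositionalEquality using (_≡_)
open import Relation.Unary using (Pred; _⊆_)
open import Level using (0ℓ)

-- ∂ on vectors of length 2^(k+1), i.e. ℓ = k + 1 ≥ 1.
∂ : (k : ℕ) → Vec ℤ (2 ^ suc k) → ℤ
∂ zero (m₁ ∷ m₂ ∷ []) = m₂ ℤ.- m₁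
∂ (suc k) v with splitAt (2 ^ suc k) v
... | (xs , ys , _) = ∂ k (cast (+-identityʳ (2 ^ suc k)) ys) ℤ.- ∂ k xs

-- an integer belongs to E ⊆ ℕ = {1,2,...}
_∈ℤ_ : ℤ → Pred ℕ 0ℓ → Set
z ∈ℤ E = Σ ℕ λ m → 1 ≤ m × z ≡ + m × E m

IsΔ : ℕ → Pred ℕ 0ℓ → Set
IsΔ k E =
  Σ (ℕ → ℕ) λ n →
    (1 ≤ n 0) × (∀ i → n i < n (suc i)) ×
    (∀ (j : Fin (2 ^ suc k) → ℕ) →
       (∀ a b → a Fin.< b → j a < j b) →
       ∂ k (tabulate (λ a → + n (j a))) ∈ℤ E)

-- The elements of E in {M+1,…,N}: a duplicate-free list of them.
-- (E need not be decidable, so |E ∩ {M+1,…,N}| ≤ c is expressed as: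
--  every such list has length ≤ c.)
InWindow : Pred ℕ 0ℓ → ℕ → ℕ → List ℕ → Set
InWindow E M N xs = Unique xs × All (λ x → M < x × x ≤ N × E x) xs

ZeroUBD : Pred ℕ 0ℓ → Set
ZeroUBD E =
  ∀ (k : ℕ) → ∃ λ L → ∀ M N → M + L ≤ N →
    ∀ xs → InWindow E M N xs → suc k * length xs ≤ N ∸ M

-- Pass to a subsequence tⱼ = n (sⱼ) of the given sequence so sparse that every term exceeds
-- twice the sum Sⱼ of the earlier terms by a margin growing like j · 3ʲ. Values of ∂ on the
-- subsequence are values of ∂ on the original sequence, so they lie in E and form a Δ_ℓ set.
-- Each of them is a signed sum Σ εᵢ tᵢ with εᵢ ∈ {-1, 0, 1}. The sums with last digit εⱼ lie
-- within Sⱼ of εⱼ tⱼ, so once tⱼ - 2Sⱼ exceeds the width W of a window, the window sees only one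
-- last digit. Peeling off digits down to the first level m at which this fails leaves at most
-- 3ᵐ signed sums in the window, and m can be chosen with 3ᵐ as small as we like relative to W.

module Submission where

open import Defs
open import Data.Nat as ℕ
  using (ℕ; zero; suc; z≤n; s≤s; _^_; _⊔_; _≤′_; ≤′-refl; ≤′-step)
import Data.Nat.Properties as ℕₚ
import Data.Nat.Tactic.RingSolver as ℕ-Ring
open import Data.Integer as ℤ using (ℤ; +_; -_; 0ℤ)
import Data.Integer.Properties as ℤₚ
import Data.Integer.Tactic.RingSolver as ℤ-Ring
open import Data.Fin as Fin using (Fin)
open import Data.Vec using (Vec; []; _∷_; splitAt; cast; tabulate; toList)
import Data.Vec.Properties as Vecₚ
open import Data.List as List using (List; []; _∷_; _++_; length; cartesianProductWith)
import Data.List.Properties as Listₚ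
open import Data.List.Membership.Propositional using (_∈_; lose)
open import Data.List.Membership.Propositional.Properties
  using (∈-map⁺; ∈-filter⁺; ∈-cartesianProductWith⁺)
import Data.List.Relation.Binary.Subset.Propositional as Subset
open import Data.List.Relation.Unary.Any as Any using (here; there)
open import Data.List.Relation.Unary.All as All using (All; []; _∷_)
import Data.List.Relation.Unary.All.Properties as Allₚ
open import Data.List.Relation.Unary.AllPairs using (_∷_)
open import Data.List.Relation.Unary.Unique.Propositional using (Unique)
import Data.List.Relation.Unary.Unique.Propositional.Properties as Uniqueₚ
open import Data.Product using (Σ; _×_; _,_; ∃; proj₁; proj₂)
open import Data.Sum using (_⊎_; inj₁; inj₂)
open import Data.Empty using (⊥; ⊥-elim)
open import Function using (_∘_)
open import Relation.Nullary using (yes; no; ¬_; ¬?)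
open import Relation.Nullary.Decidable using (_×-dec_)
open import Relation.Unary using (Pred; Decidable; _⊆_)
open import Relation.Binary.Definitions using (DecidableEquality)
open import Relation.Binary.PropositionalEquality
  using (_≡_; refl; sym; trans; cong; cong₂; subst; subst₂; module ≡-Reasoning)
open import Level using (0ℓ)

module _ (f : ℕ → ℕ) (f-step : ∀ i → f i ℕ.< f (suc i)) where

  strictlyMonotone : ∀ {i j} → i ℕ.< j → f i ℕ.< f j
  strictlyMonotone {i} {suc j} i<1+j with ℕₚ.m<1+n⇒m<n∨m≡n i<1+j
  ... | inj₁ i<j  = ℕₚ.<-trans (strictlyMonotone i<j) (f-step j)
  ... | inj₂ refl = f-step i

  monotone : ∀ {i j} → i ℕ.≤ j → f i ℕ.≤ f j
  monotone i≤j with ℕₚ.m≤n⇒m<n∨m≡n i≤j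
  ... | inj₁ i<j  = ℕₚ.<⇒≤ (strictlyMonotone i<j)
  ... | inj₂ refl = ℕₚ.≤-refl

  inflationary : ∀ i → i ℕ.≤ f i
  inflationary zero    = z≤n
  inflationary (suc i) = ℕₚ.≤-<-trans (inflationary i) (f-step i)

  lastIndexBelow : ∀ {m₀ W} → f m₀ ℕ.≤ W →
                   ∃ λ m → m₀ ℕ.≤ m × f m ℕ.≤ W × W ℕ.< f (suc m)
  lastIndexBelow {m₀} {W} = search (suc W) m₀ ℕₚ.≤-refl (ℕₚ.m≤m+n (suc W) m₀)
    where
    -- the fuel suffices because f m ≥ m
    search : ∀ fuel m → m₀ ℕ.≤ m → W ℕ.< fuel ℕ.+ m → f m ℕ.≤ W →
             ∃ λ m → m₀ ℕ.≤ m × f m ℕ.≤ W × W ℕ.< f (suc m)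
    search fuel m m₀≤m _ fm≤W with W ℕₚ.<? f (suc m)
    ... | yes W<f = m , m₀≤m , fm≤W , W<f
    search zero m _ W<m fm≤W | no _ =
      ⊥-elim (ℕₚ.<⇒≱ W<m (ℕₚ.≤-trans (inflationary m) fm≤W))
    search (suc fuel) m m₀≤m W<1+fuel+m _ | no W≮f =
      search fuel (suc m) (ℕₚ.m≤n⇒m≤1+n m₀≤m)
             (subst (W ℕ.<_) (sym (ℕₚ.+-suc fuel m)) W<1+fuel+m) (ℕₚ.≮⇒≥ W≮f)

module _ {A : Set} (_≟_ : DecidableEquality A) where

  Unique∧⊆⇒length≤ : ∀ {xs ys : List A} → Unique xs → xs Subset.⊆ ys →
                     length xs ℕ.≤ length ys
  Unique∧⊆⇒length≤ {[]}     _            _     = z≤n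
  Unique∧⊆⇒length≤ {x ∷ xs} {ys} (x∉xs ∷ xs!) xs⊆ys = ℕₚ.≤-<-trans
    (Unique∧⊆⇒length≤ xs! λ y∈xs →
       ∈-filter⁺ x≢? (xs⊆ys (there y∈xs)) (All.lookup x∉xs y∈xs))
    (Listₚ.filter-notAll x≢? ys (Any.map (λ x≡y x≢y → x≢y x≡y) (xs⊆ys (here refl))))
    where
    x≢? : Decidable (λ y → ¬ (x ≡ y))
    x≢? y = ¬? (x ≟ y)

length-cartesianProductWith : ∀ {A B C : Set} (f : A → B → C) xs ys →
  length (cartesianProductWith f xs ys) ≡ length xs ℕ.* length ys
length-cartesianProductWith f []       ys = refl
length-cartesianProductWith f (x ∷ xs) ys = begin
  length (List.map (f x) ys ++ cartesianProductWith f xs ys)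
    ≡⟨ Listₚ.length-++ (List.map (f x) ys) ⟩
  length (List.map (f x) ys) ℕ.+ length (cartesianProductWith f xs ys)
    ≡⟨ cong₂ ℕ._+_ (Listₚ.length-map (f x) ys) (length-cartesianProductWith f xs ys) ⟩
  length ys ℕ.+ length xs ℕ.* length ys ∎
  where open ≡-Reasoning

data Trit : Set where
  -1ᵗ 0ᵗ 1ᵗ : Trit

trits : List Trit
trits = -1ᵗ ∷ 0ᵗ ∷ 1ᵗ ∷ []

∈-trits : ∀ d → d ∈ trits
∈-trits -1ᵗ = here refl
∈-trits 0ᵗ  = there (here refl)
∈-trits 1ᵗ  = there (there (here refl))

candidate : {P : Trit → Set} → Decidable P → (∀ {d d′} → P d → P d′ → d ≡ d′) →
            ∃ λ d₀ → ∀ {d} → P d → d ≡ d₀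
candidate P? unique with Any.any? P? trits
... | yes ∃d = let d₀ , Pd₀ = Any.satisfied ∃d in d₀ , λ Pd → unique Pd Pd₀
... | no  ∄d = 0ᵗ , λ {d} Pd → ⊥-elim (∄d (lose (∈-trits d) Pd))

infix 8 -ᵗ_
-ᵗ_ : Trit → Trit
-ᵗ -1ᵗ = 1ᵗ
-ᵗ 0ᵗ  = 0ᵗ
-ᵗ 1ᵗ  = -1ᵗ

infixl 7 _·_
_·_ : Trit → ℤ → ℤ
-1ᵗ · x = - x
0ᵗ  · x = 0ℤ
1ᵗ  · x = x

-ᵗ-· : ∀ d x → (-ᵗ d) · x ≡ - (d · x)
-ᵗ-· -1ᵗ x = sym (ℤₚ.neg-involutive x)
-ᵗ-· 0ᵗ  x = refl
-ᵗ-· 1ᵗ  x = refl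

·-bounds : ∀ d n → - + n ℤ.≤ d · + n × d · + n ℤ.≤ + n
·-bounds -1ᵗ n = ℤₚ.≤-refl , ℤₚ.neg-≤-pos
·-bounds 0ᵗ  n = ℤₚ.neg-≤-pos , ℤ.+≤+ z≤n
·-bounds 1ᵗ  n = ℤₚ.neg-≤-pos , ℤₚ.≤-refl

-n+n≤0 : ∀ n → - + n ℤ.+ + n ℤ.≤ 0ℤ
-n+n≤0 n = ℤₚ.≤-reflexive (ℤₚ.+-inverseˡ (+ n))

-n+n≤n : ∀ n → - + n ℤ.+ + n ℤ.≤ + n
-n+n≤n n = ℤₚ.≤-trans (-n+n≤0 n) (ℤ.+≤+ z≤n)

·-separated : ∀ d d′ n →
  d ≡ d′ ⊎ d · + n ℤ.+ + n ℤ.≤ d′ · + n ⊎ d′ · + n ℤ.+ + n ℤ.≤ d · + n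
·-separated -1ᵗ -1ᵗ n = inj₁ refl
·-separated -1ᵗ 0ᵗ  n = inj₂ (inj₁ (-n+n≤0 n))
·-separated -1ᵗ 1ᵗ  n = inj₂ (inj₁ (-n+n≤n n))
·-separated 0ᵗ  -1ᵗ n = inj₂ (inj₂ (-n+n≤0 n))
·-separated 0ᵗ  0ᵗ  n = inj₁ refl
·-separated 0ᵗ  1ᵗ  n = inj₂ (inj₁ ℤₚ.≤-refl)
·-separated 1ᵗ  -1ᵗ n = inj₂ (inj₂ (-n+n≤n n))
·-separated 1ᵗ  0ᵗ  n = inj₂ (inj₂ ℤₚ.≤-refl)
·-separated 1ᵗ  1ᵗ  n = inj₁ refl

Window : ℕ → ℤ → ℤ → Set
Window w M u = M ℤ.< u × u ℤ.≤ M ℤ.+ + w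

window? : ∀ w M → Decidable (Window w M)
window? w M u = (M ℤₚ.<? u) ×-dec (u ℤₚ.≤? M ℤ.+ + w)

Window-separated : ∀ {w x M u v} → w ℕ.< x →
                   Window w M u → Window w M v → u ℤ.+ + x ℤ.≤ v → ⊥
Window-separated {w} {x} {M} {u} {v} w<x (M<u , _) (_ , v≤M+w) u+x≤v =
  ℤₚ.<-irrefl refl (begin-strict
    M ℤ.+ + w  <⟨ ℤₚ.+-monoʳ-< M (ℤ.+<+ w<x) ⟩
    M ℤ.+ + x  <⟨ ℤₚ.+-monoˡ-< (+ x) M<u ⟩
    u ℤ.+ + x  ≤⟨ u+x≤v ⟩
    v          ≤⟨ v≤M+w ⟩
    M ℤ.+ + w  ∎)
  where open ℤₚ.≤-Reasoning

Window-shift : ∀ {w M} z c → Window w M (z ℤ.+ c) → Window w (M ℤ.- c) z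
Window-shift {w} {M} z c (M<z+c , z+c≤M+w) =
  subst (M ℤ.- c ℤ.<_) (z+c-c≡z z c) (ℤₚ.+-monoˡ-< (- c) M<z+c) ,
  subst₂ ℤ._≤_ (z+c-c≡z z c) (M+w-c≡M-c+w M c (+ w)) (ℤₚ.+-monoˡ-≤ (- c) z+c≤M+w)
  where
  z+c-c≡z : ∀ z c → z ℤ.+ c ℤ.- c ≡ z
  z+c-c≡z = ℤ-Ring.solve-∀
  M+w-c≡M-c+w : ∀ M c w → M ℤ.+ w ℤ.- c ≡ M ℤ.- c ℤ.+ w
  M+w-c≡M-c+w = ℤ-Ring.solve-∀

Window-widen : ∀ {w M} z c S → Window w M (z ℤ.+ c) → - + S ℤ.≤ z → z ℤ.≤ + S →
               Window (S ℕ.+ w ℕ.+ S) (M ℤ.- + S) c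
Window-widen {w} {M} z c S (M<z+c , z+c≤M+w) -S≤z z≤S =
  (begin-strict
    M ℤ.- + S             <⟨ ℤₚ.+-monoˡ-< (- + S) M<z+c ⟩
    z ℤ.+ c ℤ.- + S       ≤⟨ ℤₚ.+-monoˡ-≤ (- + S) (ℤₚ.+-monoˡ-≤ c z≤S) ⟩
    + S ℤ.+ c ℤ.- + S     ≡⟨ ring₁ c (+ S) ⟩
    c                     ∎) ,
  (begin
    c                               ≡⟨ ring₂ z c ⟩
    z ℤ.+ c ℤ.- z                   ≤⟨ ℤₚ.+-mono-≤ z+c≤M+w (ℤₚ.neg-mono-≤ -S≤z) ⟩
    M ℤ.+ + w ℤ.- - + S             ≡⟨ ring₃ M (+ w) (+ S) ⟩
    M ℤ.- + S ℤ.+ (+ S ℤ.+ + w ℤ.+ + S) ∎)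
  where
  open ℤₚ.≤-Reasoning
  ring₁ : ∀ c S → S ℤ.+ c ℤ.- S ≡ c
  ring₁ = ℤ-Ring.solve-∀
  ring₂ : ∀ z c → c ≡ z ℤ.+ c ℤ.- z
  ring₂ = ℤ-Ring.solve-∀
  ring₃ : ∀ M w S → M ℤ.+ w ℤ.- - S ≡ M ℤ.- S ℤ.+ (S ℤ.+ w ℤ.+ S)
  ring₃ = ℤ-Ring.solve-∀

Increasing : ∀ {m} → (Fin m → ℕ) → Set
Increasing j = ∀ a b → a Fin.< b → j a ℕ.< j b

ΔValues : ℕ → (ℕ → ℕ) → Pred ℕ 0ℓ
ΔValues k t x = ∃ λ (j : Fin (2 ^ suc k) → ℕ) →
  Increasing j × ∂ k (tabulate (λ a → + t (j a))) ≡ + x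

partialSum : (ℕ → ℕ) → ℕ → ℕ
partialSum t zero    = 0
partialSum t (suc J) = partialSum t J ℕ.+ t J

module SignedSums (t : ℕ → ℕ) where

  infixl 5 _▷_
  data SignedSum (a : ℕ) : ℕ → ℤ → Set where
    []  : SignedSum a a 0ℤ
    _▷_ : ∀ {b z} → SignedSum a b z → (d : Trit) → SignedSum a (suc b) (z ℤ.+ d · + t b)

  negate : ∀ {a b z} → SignedSum a b z → SignedSum a b (- z)
  negate []                  = []
  negate (_▷_ {b} {z} s d) = subst (SignedSum _ _) (-z+[-d]t≡-[z+dt]) (negate s ▷ -ᵗ d)
    where
    -z+[-d]t≡-[z+dt] : - z ℤ.+ (-ᵗ d) · + t b ≡ - (z ℤ.+ d · + t b)
    -z+[-d]t≡-[z+dt] =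
      trans (cong (λ u → - z ℤ.+ u) (-ᵗ-· d (+ t b))) (sym (ℤₚ.neg-distrib-+ z _))

  append : ∀ {a b c x y} → SignedSum a b x → SignedSum b c y → SignedSum a c (x ℤ.+ y)
  append {x = x} s []                  = subst (SignedSum _ _) (sym (ℤₚ.+-identityʳ x)) s
  append {x = x} s (_▷_ {z = y} s′ d) =
    subst (SignedSum _ _) (ℤₚ.+-assoc x y _) (append s s′ ▷ d)

  difference : ∀ {a b c x y} → SignedSum a b x → SignedSum b c y → SignedSum a c (y ℤ.- x)
  difference {x = x} {y} s s′ = subst (SignedSum _ _) (ℤₚ.+-comm (- x) y) (append (negate s) s′)

  extend : ∀ {a b c z} → b ≤′ c → SignedSum a b z → SignedSum a c z
  extend ≤′-refl        s = s
  extend (≤′-step b≤′c) s =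
    subst (SignedSum _ _) (ℤₚ.+-identityʳ _) (extend b≤′c s ▷ 0ᵗ)

  single : ∀ {a b j} → a ℕ.≤ j → j ℕ.< b → SignedSum a b (+ t j)
  single a≤j j<b = extend (ℕₚ.≤⇒≤′ j<b) (extend (ℕₚ.≤⇒≤′ a≤j) [] ▷ 1ᵗ)

  data Selection (lo hi : ℕ) : List ℤ → Set where
    []   : lo ℕ.≤ hi → Selection lo hi []
    pick : ∀ {j xs} → lo ℕ.≤ j → Selection (suc j) hi xs → Selection lo hi (+ t j ∷ xs)

  Selection-++⁻ : ∀ xs {ys lo hi} → Selection lo hi (xs ++ ys) →
                  ∃ λ mid → Selection lo mid xs × Selection mid hi ys
  Selection-++⁻ []       sel             = _ , [] ℕₚ.≤-refl , sel
  Selection-++⁻ (x ∷ xs) (pick lo≤j sel) =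
    let mid , sel₁ , sel₂ = Selection-++⁻ xs sel in mid , pick lo≤j sel₁ , sel₂

  ∂-SignedSum : ∀ k (v : Vec ℤ (2 ^ suc k)) {lo hi} → Selection lo hi (toList v) →
                SignedSum lo hi (∂ k v)
  ∂-SignedSum zero (_ ∷ _ ∷ []) (pick lo≤i (pick i<j ([] j<hi))) =
    difference (single lo≤i ℕₚ.≤-refl) (single i<j j<hi)
  ∂-SignedSum (suc k) v sel with splitAt (2 ^ suc k) v
  ... | xs , ys , refl =
    let mid , sel₁ , sel₂ =
          Selection-++⁻ (toList xs) (subst (Selection _ _) (Vecₚ.toList-++ xs ys) sel)
    in difference (∂-SignedSum k xs sel₁)
                  (∂-SignedSum k (cast _ ys)
                               (subst (Selection _ _) (sym (Vecₚ.toList-cast _ ys)) sel₂))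

  tabulate-Selection : ∀ {m lo} (j : Fin m → ℕ) → Increasing j → (∀ a → lo ℕ.≤ j a) →
                       ∃ λ hi → Selection lo hi (toList (tabulate (λ a → + t (j a))))
  tabulate-Selection {zero} {lo} j _ _ = lo , [] ℕₚ.≤-refl
  tabulate-Selection {suc m} j j↑ lo≤j =
    let hi , sel = tabulate-Selection (j ∘ Fin.suc) (λ a b a<b → j↑ _ _ (s≤s a<b))
                                      (λ a → j↑ Fin.zero (Fin.suc a) (s≤s z≤n))
    in hi , pick (lo≤j Fin.zero) sel

  IsSignedSum : Pred ℕ 0ℓ
  IsSignedSum x = ∃ λ J → SignedSum 0 J (+ x)

  ΔValues⊆IsSignedSum : ∀ k → ΔValues k t ⊆ IsSignedSum
  ΔValues⊆IsSignedSum k (j , j↑ , ∂≡x) =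
    let hi , sel = tabulate-Selection j j↑ (λ _ → z≤n)
    in hi , subst (SignedSum 0 hi) ∂≡x (∂-SignedSum k _ sel)

  SignedSum-bounds : ∀ {a b z} → SignedSum a b z →
                     - + partialSum t b ℤ.≤ z × z ℤ.≤ + partialSum t b
  SignedSum-bounds []               = ℤₚ.neg-≤-pos , ℤ.+≤+ z≤n
  SignedSum-bounds (_▷_ {b} {z} s d) =
    let -S≤z , z≤S = SignedSum-bounds s
        -t≤dt , dt≤t = ·-bounds d (t b)
    in subst (ℤ._≤ z ℤ.+ d · + t b) (sym (ℤₚ.neg-distrib-+ (+ partialSum t b) (+ t b)))
             (ℤₚ.+-mono-≤ -S≤z -t≤dt) ,
       ℤₚ.+-mono-≤ z≤S dt≤t

  signedSums : ℕ → List ℤ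
  signedSums zero    = 0ℤ ∷ []
  signedSums (suc J) = cartesianProductWith (λ z d → z ℤ.+ d · + t J) (signedSums J) trits

  length-signedSums : ∀ J → length (signedSums J) ≡ 3 ^ J
  length-signedSums zero    = refl
  length-signedSums (suc J) = begin
    length (signedSums (suc J))  ≡⟨ length-cartesianProductWith _ (signedSums J) trits ⟩
    length (signedSums J) ℕ.* 3  ≡⟨ cong (ℕ._* 3) (length-signedSums J) ⟩
    3 ^ J ℕ.* 3                  ≡⟨ ℕₚ.*-comm (3 ^ J) 3 ⟩
    3 ^ suc J                    ∎
    where open ≡-Reasoning

  ∈-signedSums : ∀ {J z} → SignedSum 0 J z → z ∈ signedSums J
  ∈-signedSums []      = here refl
  ∈-signedSums (s ▷ d) = ∈-cartesianProductWith⁺ _ (∈-signedSums s) (∈-trits d)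

  commonLength : ∀ {zs} → All (λ z → ∃ λ J → SignedSum 0 J z) zs →
                 ∃ λ J → All (SignedSum 0 J) zs
  commonLength []               = 0 , []
  commonLength ((J , s) ∷ ss) =
    let J′ , ss′ = commonLength ss
    in J ⊔ J′ , extend (ℕₚ.≤⇒≤′ (ℕₚ.m≤m⊔n J J′)) s
              ∷ All.map (extend (ℕₚ.≤⇒≤′ (ℕₚ.m≤n⊔m J J′))) ss′

module Covering (t : ℕ → ℕ) (m w : ℕ)
                (gap : ∀ J → m ℕ.≤ J → 2 ℕ.* partialSum t J ℕ.+ w ℕ.< t J) where
  open SignedSums t

  Cover : ℕ → ℤ → Set
  Cover J M = ∃ λ ys →
    length ys ℕ.≤ 3 ^ m × (∀ {z} → SignedSum 0 J z → Window w M z → z ∈ ys)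

  cover : ∀ J M → Cover J M
  cover J M with J ℕₚ.≤? m
  ... | yes J≤m = signedSums J ,
                  subst (ℕ._≤ 3 ^ m) (sym (length-signedSums J)) (ℕₚ.^-monoʳ-≤ 3 J≤m) ,
                  λ s _ → ∈-signedSums s
  cover zero    M | no 0≰m   = ⊥-elim (0≰m z≤n)
  cover (suc J) M | no 1+J≰m = List.map (λ u → u ℤ.+ c₀) ys ,
                               subst (ℕ._≤ 3 ^ m) (sym (Listₚ.length-map _ ys)) |ys|≤3^m ,
                               covers
    where
    S x : ℕ
    S = partialSum t J
    x = t J

    -- s ▷ d lies within S of d · x, so it can be in the window only if Meets d
    Meets : Trit → Set
    Meets d = Window (S ℕ.+ w ℕ.+ S) (M ℤ.- + S) (d · + x)

    S+w+S<x : S ℕ.+ w ℕ.+ S ℕ.< x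
    S+w+S<x = subst (ℕ._< x) (2S+w≡S+w+S S w) (gap J (ℕₚ.≤-pred (ℕₚ.≰⇒> 1+J≰m)))
      where
      2S+w≡S+w+S : ∀ S w → 2 ℕ.* S ℕ.+ w ≡ S ℕ.+ w ℕ.+ S
      2S+w≡S+w+S = ℕ-Ring.solve-∀

    Meets-unique : ∀ {d d′} → Meets d → Meets d′ → d ≡ d′
    Meets-unique {d} {d′} d-meets d′-meets with ·-separated d d′ x
    ... | inj₁ d≡d′        = d≡d′
    ... | inj₂ (inj₁ d<d′) = ⊥-elim (Window-separated S+w+S<x d-meets d′-meets d<d′)
    ... | inj₂ (inj₂ d′<d) = ⊥-elim (Window-separated S+w+S<x d′-meets d-meets d′<d)

    topDigit : ∃ λ d₀ → ∀ {d} → Meets d → d ≡ d₀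
    topDigit = candidate (λ d → window? _ _ (d · + x)) Meets-unique

    c₀ : ℤ
    c₀ = proj₁ topDigit · + x

    rest : Cover J (M ℤ.- c₀)
    rest = cover J (M ℤ.- c₀)

    ys : List ℤ
    ys = proj₁ rest

    |ys|≤3^m : length ys ℕ.≤ 3 ^ m
    |ys|≤3^m = proj₁ (proj₂ rest)

    meets : ∀ {z} d → SignedSum 0 J z → Window w M (z ℤ.+ d · + x) → Meets d
    meets {z} d s z∈W =
      let -S≤z , z≤S = SignedSum-bounds s in Window-widen z (d · + x) S z∈W -S≤z z≤S

    covers : ∀ {z} → SignedSum 0 (suc J) z → Window w M z →
             z ∈ List.map (λ u → u ℤ.+ c₀) ys
    covers (_▷_ {z = z} s d) z∈W with proj₂ topDigit {d} (meets d s z∈W)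
    ... | refl = ∈-map⁺ _ (proj₂ (proj₂ rest) s (Window-shift z c₀ z∈W))

  windowCount : ∀ {M zs} → Unique zs →
                All (λ z → Window w M z × ∃ λ J → SignedSum 0 J z) zs → length zs ℕ.≤ 3 ^ m
  windowCount {M} zs! zs-in =
    let J , sums = commonLength (All.map proj₂ zs-in)
        ys , |ys|≤3^m , covers = cover J M
    in ℕₚ.≤-trans (Unique∧⊆⇒length≤ ℤₚ._≟_ zs! λ z∈zs →
                    covers (All.lookup sums z∈zs) (proj₁ (All.lookup zs-in z∈zs)))
                  |ys|≤3^m

ZeroUBD-⊆ : ∀ {F G : Pred ℕ 0ℓ} → F ⊆ G → ZeroUBD G → ZeroUBD F
ZeroUBD-⊆ F⊆G G-null k =
  let L , bound = G-null k
  in L , λ M N M+L≤N xs (xs! , xs∈F) →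
           bound M N M+L≤N xs (xs! , All.map (λ (M<x , x≤N , Fx) → M<x , x≤N , F⊆G Fx) xs∈F)

-- at least c · 3 ^ suc J once suc J ≥ c, whatever c: one sequence serves every density 1 / c
threshold : ℕ → ℕ
threshold J = suc J ℕ.* 3 ^ suc J

Lacunary : (ℕ → ℕ) → Set
Lacunary t = ∀ J → 2 ℕ.* partialSum t J ℕ.+ threshold J ℕ.≤ t J

threshold>0 : ∀ J → 0 ℕ.< threshold J
threshold>0 J = ℕₚ.*-mono-≤ (s≤s (z≤n {J})) (ℕₚ.m^n>0 3 (suc J))

threshold-monotone : ∀ {i j} → i ℕ.≤ j → threshold i ℕ.≤ threshold j
threshold-monotone i≤j = ℕₚ.*-mono-≤ (s≤s i≤j) (ℕₚ.^-monoʳ-≤ 3 (s≤s i≤j))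

lacunary-windowCount : ∀ t → Lacunary t → ∀ {m w M zs} → w ℕ.< threshold m → Unique zs →
  All (λ z → Window w M z × ∃ λ J → SignedSums.SignedSum t 0 J z) zs → length zs ℕ.≤ 3 ^ m
lacunary-windowCount t lacunary {m} {w} w<θ = windowCount
  where
  open Covering t m w (λ J m≤J →
    ℕₚ.<-≤-trans (ℕₚ.+-monoʳ-< _ (ℕₚ.<-≤-trans w<θ (threshold-monotone m≤J)))
                 (lacunary J))

lacunary⇒ZeroUBD : ∀ t → Lacunary t → ZeroUBD (SignedSums.IsSignedSum t)
lacunary⇒ZeroUBD t lacunary k = c3^ k , bound
  where
  open SignedSums t

  c3^ : ℕ → ℕ
  c3^ i = suc k ℕ.* 3 ^ i

  c3^-step : ∀ i → c3^ i ℕ.< c3^ (suc i)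
  c3^-step i = ℕₚ.*-monoʳ-< (suc k) (subst (3 ^ i ℕ.<_) (ℕₚ.*-comm (3 ^ i) 3)
    (ℕₚ.m<m*n (3 ^ i) 3 {{ℕₚ.m^n≢0 3 i}} (s≤s (s≤s z≤n))))

  bound : ∀ M N → M ℕ.+ c3^ k ℕ.≤ N → ∀ xs → InWindow IsSignedSum M N xs →
          suc k ℕ.* length xs ℕ.≤ N ℕ.∸ M
  bound M N M+c≤N xs (xs! , xs∈) =
    let m , k≤m , c3^m≤W , W<c3^[1+m] = lastIndexBelow c3^ c3^-step {k} c3^k≤W
        W<θ = ℕₚ.<-≤-trans W<c3^[1+m] (ℕₚ.*-monoˡ-≤ (3 ^ suc m) (s≤s k≤m))
    in ℕₚ.≤-trans (ℕₚ.*-monoʳ-≤ (suc k) (|xs|≤3^ {m} W<θ)) c3^m≤W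
    where
    W : ℕ
    W = N ℕ.∸ M

    M+W≡N : M ℕ.+ W ≡ N
    M+W≡N = ℕₚ.m+[n∸m]≡n (ℕₚ.≤-trans (ℕₚ.m≤m+n M (c3^ k)) M+c≤N)

    c3^k≤W : c3^ k ℕ.≤ W
    c3^k≤W = subst (ℕ._≤ W) (ℕₚ.m+n∸m≡n M (c3^ k)) (ℕₚ.∸-monoˡ-≤ M M+c≤N)

    |xs|≤3^ : ∀ {m} → W ℕ.< threshold m → length xs ℕ.≤ 3 ^ m
    |xs|≤3^ {m} W<θ = subst (ℕ._≤ 3 ^ m) (Listₚ.length-map +_ xs)
      (lacunary-windowCount t lacunary {m} W<θ
      (Uniqueₚ.map⁺ ℤₚ.+-injective xs!)
      (Allₚ.map⁺ (All.map (λ (M<x , x≤N , x-sum) →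
        (ℤ.+<+ M<x , ℤ.+≤+ (subst (_ ℕ.≤_) (sym M+W≡N) x≤N)) , x-sum) xs∈)))

module Sparse (n : ℕ → ℕ) (n↑ : ∀ i → n i ℕ.< n (suc i)) where

  mutual
    sparseIndex : ℕ → ℕ
    sparseIndex J = 2 ℕ.* sparseSum J ℕ.+ threshold J

    sparseSum : ℕ → ℕ
    sparseSum zero    = 0
    sparseSum (suc J) = sparseSum J ℕ.+ n (sparseIndex J)

  partialSum-sparse : ∀ J → partialSum (n ∘ sparseIndex) J ≡ sparseSum J
  partialSum-sparse zero    = refl
  partialSum-sparse (suc J) = cong (ℕ._+ n (sparseIndex J)) (partialSum-sparse J)

  lacunary-sparse : Lacunary (n ∘ sparseIndex)
  lacunary-sparse J rewrite partialSum-sparse J = inflationary n n↑ (sparseIndex J)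

  sparseIndex-step : ∀ J → sparseIndex J ℕ.< sparseIndex (suc J)
  sparseIndex-step J = begin-strict
    sparseIndex J               ≤⟨ inflationary n n↑ (sparseIndex J) ⟩
    n (sparseIndex J)           ≤⟨ ℕₚ.m≤n+m _ (sparseSum J) ⟩
    sparseSum (suc J)           ≤⟨ ℕₚ.m≤m+n _ _ ⟩
    2 ℕ.* sparseSum (suc J)     <⟨ ℕₚ.m<m+n _ (threshold>0 (suc J)) ⟩
    sparseIndex (suc J)         ∎
    where open ℕₚ.≤-Reasoning

Increasing-∘ : ∀ {s m} {j : Fin m → ℕ} → (∀ i → s i ℕ.< s (suc i)) →
               Increasing j → Increasing (s ∘ j)
Increasing-∘ {s} s↑ j↑ a b a<b = strictlyMonotone s s↑ (j↑ a b a<b)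

ΔValues-subsequence⊆ : ∀ {k E} (ΔE : IsΔ k E) {s} → (∀ i → s i ℕ.< s (suc i)) →
                        ΔValues k (proj₁ ΔE ∘ s) ⊆ E
ΔValues-subsequence⊆ {E = E} (n , _ , _ , n-Δ) {s} s↑ (j , j↑ , ∂≡x) =
  let _ , _ , ∂≡y , Ey = n-Δ (s ∘ j) (Increasing-∘ s↑ j↑)
  in subst E (ℤₚ.+-injective (trans (sym ∂≡y) ∂≡x)) Ey

IsΔ-subsequence : ∀ {k E} (ΔE : IsΔ k E) {s} → (∀ i → s i ℕ.< s (suc i)) →
                  IsΔ k (ΔValues k (proj₁ ΔE ∘ s))
IsΔ-subsequence (n , 1≤n₀ , n↑ , n-Δ) {s} s↑ =
  n ∘ s ,
  ℕₚ.≤-trans 1≤n₀ (monotone n n↑ z≤n) ,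
  (λ i → strictlyMonotone n n↑ (s↑ i)) ,
  λ j j↑ → let y , 1≤y , ∂≡y , _ = n-Δ (s ∘ j) (Increasing-∘ s↑ j↑)
           in y , 1≤y , ∂≡y , j , j↑ , ∂≡y

lemma8p6 : (k : ℕ) (E : Pred ℕ 0ℓ) → IsΔ k E →
    Σ (Pred ℕ 0ℓ) λ F → F ⊆ E × IsΔ k F × ZeroUBD F
lemma8p6 k E ΔE@(n , _ , n↑ , _) =
  ΔValues k (n ∘ sparseIndex) ,
  ΔValues-subsequence⊆ {k} ΔE sparseIndex-step ,
  IsΔ-subsequence {k} ΔE sparseIndex-step ,
  ZeroUBD-⊆ (SignedSums.ΔValues⊆IsSignedSum (n ∘ sparseIndex) k)
            (lacunary⇒ZeroUBD (n ∘ sparseIndex) lacunary-sparse)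
  where open Sparse n n↑
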